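{- Let $U$ and $V_n$ ($n<\omega$) be ultrafilters on $\omega$, and suppose there is $X_0\in U$ such that $V_n\le_T V_m$ for all $n\le m$ in $X_0$. Then $\sum_UV_n\equiv_T U\times\prod_{n\in X_0}V_n$, and $\sum_UV_n$ is the greatest lower bound of $\mathcal{B}=\{U\times\prod_{n\in X}V_n:X\in U\}$ in the Tukey order: $\sum_UV_n\le_T B$ for every $B\in\mathcal{B}$, and every directed poset $\mathbb{P}$ with $\mathbb{P}\le_T B$ for all $B\in\mathcal{B}$ satisfies $\mathbb{P}\le_T\sum_UV_n$.
   Context: $\sum_UV_n$ is the ultrafilter on $\omega\times\omega$ with $A\in\sum_UV_n$ iff $\{n:\{m:(n,m)\in A\}\in V_n\}\in U$. Ultrafilters are ordered by reverse inclusion; $U\times\prod_{n\in X}V_n$ is ordered coordinatewise. $P\le_T Q$ (Tukey) means there is a map $Q\to P$ sending cofinal subsets to cofinal subsets; $\equiv_T$ means both directions. -}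

module Defs where

open import Level using (Level; _⊔_; 0ℓ) renaming (suc to lsuc)
open import Data.Unit using (⊤)
open import Data.Empty using (⊥)
open import Data.Nat using (ℕ; _<_)
open import Data.Product using (Σ; ∃; _×_; _,_; proj₁; proj₂)
open import Data.Sum using (_⊎_)
open import Relation.Nullary using (¬_)
open import Relation.Unary using (Pred; _⊆_; _∩_; ∁)
open import Relation.Binary.Bundles using (Poset)
open import Relation.Binary.Structures using (IsPartialOrder; IsPreorder; IsEquivalence)
open import Data.Product.Relation.Binary.Pointwise.NonDependent using (×-poset)

Subset : Set → Set₁
Subset I = I → Set

FiniteSet : Subset ℕ → Set
FiniteSet A = ∃ λ k → ∀ m → A m → m < k

-- U is an ultrafilter on I (U is the membership predicate "A ∈ U").
record IsUltrafilter {I : Set} (U : Subset I → Set) : Set₁ where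
  field
    whole  : U (λ _ → ⊤)
    proper : ¬ U (λ _ → ⊥)
    upward : ∀ {A B : Subset I} → A ⊆ B → U A → U B
    meet   : ∀ {A B : Subset I} → U A → U B → U (A ∩ B)
    ultra  : ∀ (A : Subset I) → U A ⊎ U (∁ A)

record IsNonprincipalUltrafilter (U : Subset ℕ → Set) : Set₁ where
  field
    isUltrafilter : IsUltrafilter U
    noFinite      : ∀ (A : Subset ℕ) → FiniteSet A → ¬ U A

∑ : (U : Subset ℕ → Set) (V : ℕ → Subset ℕ → Set) → Subset (ℕ × ℕ) → Set
∑ U V A = U (λ n → V n (λ m → A (n , m)))

filterPoset : {I : Set} (F : Subset I → Set) → Poset (lsuc 0ℓ) 0ℓ 0ℓ
filterPoset {I} F = record
  { Carrier = Σ (Subset I) F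
  ; _≈_ = λ a b → (proj₁ a ⊆ proj₁ b) × (proj₁ b ⊆ proj₁ a)
  ; _≤_ = λ a b → proj₁ b ⊆ proj₁ a
  ; isPartialOrder = record
    { isPreorder = record
      { isEquivalence = record
        { refl = (λ x → x) , (λ x → x)
        ; sym = λ { (p , q) → q , p }
        ; trans = λ { (p , q) (r , s) → (λ x → r (p x)) , (λ x → q (s x)) }
        }
      ; reflexive = λ { (p , q) → q }
      ; trans = λ p q x → p (q x)
      }
    ; antisym = λ p q → q , p
    }
  }

∏∈ : (X : Subset ℕ) (P : ℕ → Poset (lsuc 0ℓ) 0ℓ 0ℓ) → Poset (lsuc 0ℓ) 0ℓ 0ℓ
∏∈ X P = record
  { Carrier = (n : ℕ) → Poset.Carrier (P n)
  ; _≈_ = λ f g → ∀ n → X n → Poset._≈_ (P n) (f n) (g n)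
  ; _≤_ = λ f g → ∀ n → X n → Poset._≤_ (P n) (f n) (g n)
  ; isPartialOrder = record
    { isPreorder = record
      { isEquivalence = record
        { refl = λ n x → Poset.Eq.refl (P n)
        ; sym = λ p n x → Poset.Eq.sym (P n) (p n x)
        ; trans = λ p q n x → Poset.Eq.trans (P n) (p n x) (q n x)
        }
      ; reflexive = λ p n x → Poset.reflexive (P n) (p n x)
      ; trans = λ p q n x → Poset.trans (P n) (p n x) (q n x)
      }
    ; antisym = λ p q n x → Poset.antisym (P n) (p n x) (q n x)
    }
  }

_×ₚ_ : ∀ {a b c d e f} → Poset a b c → Poset d e f → Poset _ _ _
P ×ₚ Q = ×-poset P Q

Directed : ∀ {c ℓ₁ ℓ₂} → Poset c ℓ₁ ℓ₂ → Set (c ⊔ ℓ₂)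
Directed P = ∀ x y → ∃ λ z → (x ≤ z) × (y ≤ z)
  where open Poset P

Cofinal : ∀ {c ℓ₁ ℓ₂ ℓ} (P : Poset c ℓ₁ ℓ₂) → Pred (Poset.Carrier P) ℓ → Set (c ⊔ ℓ₂ ⊔ ℓ)
Cofinal P C = ∀ p → ∃ λ q → C q × (p ≤ q)
  where open Poset P

image : ∀ {c₁ ℓ₁ ℓ₂ c₂ ℓ₃ ℓ₄ ℓ} (Q : Poset c₁ ℓ₁ ℓ₂) (P : Poset c₂ ℓ₃ ℓ₄)
        (f : Poset.Carrier Q → Poset.Carrier P) → Pred (Poset.Carrier Q) ℓ →
        Pred (Poset.Carrier P) (c₁ ⊔ ℓ₃ ⊔ ℓ)
image Q P f C p = ∃ λ q → C q × Poset._≈_ P (f q) p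

_≤T_ : ∀ {c₁ ℓ₁ ℓ₂ c₂ ℓ₃ ℓ₄} → Poset c₁ ℓ₁ ℓ₂ → Poset c₂ ℓ₃ ℓ₄ → Set _
_≤T_ {c₂ = c₂} P Q =
  Σ (Poset.Carrier Q → Poset.Carrier P) λ f →
    ∀ (C : Pred (Poset.Carrier Q) c₂) → Cofinal Q C → Cofinal P (image Q P f C)

_≡T_ : ∀ {c₁ ℓ₁ ℓ₂ c₂ ℓ₃ ℓ₄} → Poset c₁ ℓ₁ ℓ₂ → Poset c₂ ℓ₃ ℓ₄ → Set _
P ≡T Q = (P ≤T Q) × (Q ≤T P)

{-# OPTIONS --safe #-}

-- Tukey reductions are witnessed by convergent maps, and classically every Tukey map is one.
-- For X ∈ U, (A , B) ↦ ⨁ (A ∩ X) B = {(n , m) | n ∈ A ∩ X, m ∈ B n} is convergent from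
-- U × ∏_X V_n to ∑ U V.  Conversely S ∈ ∑ U V goes to its projection {n | S_n ∈ V_n}
-- together with, in coordinate k, the image of a fibre S_n (n ≥ k in X₀, S_n ∈ V_n, which
-- exists as U is nonprincipal) under a convergent map V_n → V_k.  This is convergent: below
-- (A , B) it suffices to take the fibres over A ∩ X₀ inside the intersection, over the
-- finitely many k ≤ n, of the thresholds for B k.  Composing with it gives the lower bound
-- property, without using directedness.
module Submission where

open import Defs
open import Level using (Level; Lift; lift; _⊔_; 0ℓ) renaming (suc to lsuc)
open import Data.Nat using (ℕ; _≤_; _<_; zero; suc; s≤s)
open import Data.Nat.Properties using (≰⇒>; m<1+n⇒m<n∨m≡n)
open import Data.Product using (_×_; Σ; ∃; _,_; proj₁; proj₂)
open import Data.Sum using (inj₁; inj₂)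
open import Data.Empty using (⊥-elim)
open import Data.Unit using (⊤)
open import Relation.Nullary using (¬_; Dec; yes; no)
open import Relation.Binary.PropositionalEquality using (_≡_; refl)
open import Axiom.ExcludedMiddle using (ExcludedMiddle)
open import Axiom.DoubleNegationElimination using (DoubleNegationElimination; em⇒dne)
open import Relation.Unary using (_⊆_; _∩_; Pred)
open import Relation.Binary.Bundles using (Poset)

private
  variable
    a b ℓ c₁ c₂ ℓ₁ ℓ₂ ℓ₃ ℓ₄ ℓ₅ ℓ₆ : Level

witness-when : {A : Set a} {B : A → Set b} {P : Set ℓ} →
               Dec P → A → (P → Σ A B) → Σ A λ x → P → B x
witness-when (yes p) _ f = proj₁ (f p) , λ _ → proj₂ (f p)
witness-when (no ¬p) x _ = x , λ p → ⊥-elim (¬p p)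

module _ (P : Poset c₁ ℓ₁ ℓ₂) (Q : Poset c₂ ℓ₃ ℓ₄) where
  private
    module P = Poset P
    module Q = Poset Q

  Convergent : (Q.Carrier → P.Carrier) → Set (c₁ ⊔ c₂ ⊔ ℓ₂ ⊔ ℓ₄)
  Convergent f = ∀ p → ∃ λ q → ∀ q′ → q Q.≤ q′ → p P.≤ f q′

  convergent-image-cofinal : ∀ {f ℓ} {C : Pred Q.Carrier ℓ} → Convergent f → Cofinal Q C →
                             Cofinal P (λ p → ∃ λ q → C q × f q ≡ p)
  convergent-image-cofinal {f} conv cofinal p =
    let (q , eventually-above) = conv p
        (q′ , q′∈C , q≤q′) = cofinal q
    in f q′ , (q′ , q′∈C , refl) , eventually-above q′ q≤q′

  convergent⇒≤T : ∀ {f} → Convergent f → P ≤T Q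
  convergent⇒≤T {f} conv = f , λ C cofinal p → weaken (convergent-image-cofinal conv cofinal p)
    where
    weaken : ∀ {C : Pred Q.Carrier c₂} {p} → (∃ λ r → (∃ λ q → C q × f q ≡ r) × p P.≤ r) →
             ∃ λ r → image Q P f C r × p P.≤ r
    weaken (r , (q , q∈C , refl) , p≤r) = r , (q , q∈C , P.Eq.refl) , p≤r

-- If f were not convergent at p, the q′ with p ≰ f q′ would form a cofinal set
-- whose image has no element above p.  Hence Q's carrier level must bound P's order level.
≤T⇒convergent : (∀ {ℓ} → ExcludedMiddle ℓ) →
                {P : Poset c₁ ℓ₁ ℓ₂} {Q : Poset (c₂ ⊔ ℓ₂) ℓ₃ ℓ₄} →
                (t : P ≤T Q) → Convergent P Q (proj₁ t)
≤T⇒convergent {c₂ = c₂} lem {P} {Q} (f , tukey) p = dne λ unbounded →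
  let C : Pred Q.Carrier _
      C q′ = Lift c₂ (¬ p P.≤ f q′)
      cofinal : Cofinal Q C
      cofinal q = dne λ ¬above → unbounded
        (q , λ q′ q≤q′ → dne λ p≰fq′ → ¬above (q′ , lift p≰fq′ , q≤q′))
      (r , (q′ , lift p≰fq′ , fq′≈r) , p≤r) = tukey C cofinal p
  in p≰fq′ (P.≤-respʳ-≈ (P.Eq.sym fq′≈r) p≤r)
  where
  module P = Poset P
  module Q = Poset Q
  dne : ∀ {ℓ} → DoubleNegationElimination ℓ
  dne = em⇒dne lem

≤T-∘-convergent : {P : Poset c₁ ℓ₁ ℓ₂} {Q : Poset c₂ ℓ₃ ℓ₄} {R : Poset c₂ ℓ₅ ℓ₆} →
                  P ≤T Q → ∀ {g} → Convergent Q R g → P ≤T R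
≤T-∘-convergent {P = P} {Q} {R} (f , tukey) {g} conv = (λ r → f (g r)) , λ C cofinal p →
  reindex (tukey _ (convergent-image-cofinal Q R conv cofinal) p)
  where
  reindex : ∀ {C : Pred (Poset.Carrier R) _} {p} →
            (∃ λ r → image Q P f (λ q → ∃ λ c → C c × g c ≡ q) r × Poset._≤_ P p r) →
            ∃ λ r → image R P (λ c → f (g c)) C r × Poset._≤_ P p r
  reindex (r , (q , (c , c∈C , refl) , fq≈r) , p≤r) = r , (c , c∈C , fq≈r) , p≤r

module UltrafilterProperties {I : Set} {F : Subset I → Set} (F-ultra : IsUltrafilter F) where
  open IsUltrafilter F-ultra

  ⊤ᶠ : Poset.Carrier (filterPoset F)
  ⊤ᶠ = (λ _ → ⊤) , whole

  -- The set that is A when A ∈ F and all of I otherwise, without deciding A ∈ F.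
  guarded-∈ : ∀ A → F (λ x → F A → A x)
  guarded-∈ A with ultra A
  ... | inj₁ A∈F  = upward (λ Ax _ → Ax) A∈F
  ... | inj₂ ∁A∈F =
    upward (λ _ A∈F → ⊥-elim (proper (upward (λ (Ax , ¬Ax) → ¬Ax Ax) (meet A∈F ∁A∈F)))) whole

  ⋂<-∈ : (G : ℕ → Subset I) → (∀ k → F (G k)) → ∀ j → F (λ x → ∀ k → k < j → G k x)
  ⋂<-∈ G G∈F zero    = upward (λ _ _ ()) whole
  ⋂<-∈ G G∈F (suc j) = upward extend (meet (⋂<-∈ G G∈F j) (G∈F j))
    where
    extend : ∀ {x} → (∀ k → k < j → G k x) × G j x → ∀ k → k < suc j → G k x
    extend (below , Gjx) k k<1+j with m<1+n⇒m<n∨m≡n k<1+j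
    ... | inj₁ k<j  = below k k<j
    ... | inj₂ refl = Gjx

  const-∈⇒ : DoubleNegationElimination 0ℓ → {P : Set} → F (λ _ → P) → P
  const-∈⇒ dne P∈F = dne λ ¬P → proper (upward ¬P P∈F)

∈⇒unbounded : DoubleNegationElimination 0ℓ → {U : Subset ℕ → Set} → IsNonprincipalUltrafilter U →
              ∀ {A} → U A → ∀ k → ∃ λ n → k ≤ n × A n
∈⇒unbounded dne U-np {A} A∈U k =
  dne λ none → IsNonprincipalUltrafilter.noFinite U-np A
                 (k , λ m Am → ≰⇒> λ k≤m → none (m , k≤m , Am)) A∈U

module UltrafilterSum {U : Subset ℕ → Set} {V : ℕ → Subset ℕ → Set}
                      (U-ultra : IsUltrafilter U) (V-ultra : ∀ n → IsUltrafilter (V n)) where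
  private
    module U = IsUltrafilter U-ultra
    module V n = IsUltrafilter (V-ultra n)

  ℙ∑ : Poset (lsuc 0ℓ) 0ℓ 0ℓ
  ℙ∑ = filterPoset (∑ U V)

  ℙ∏ : Subset ℕ → Poset (lsuc 0ℓ) 0ℓ 0ℓ
  ℙ∏ X = filterPoset U ×ₚ ∏∈ X (λ n → filterPoset (V n))

  fibre : Subset (ℕ × ℕ) → ℕ → Subset ℕ
  fibre S n m = S (n , m)

  projection : Subset (ℕ × ℕ) → Subset ℕ
  projection S n = V n (fibre S n)

  ⨁ : Subset ℕ → (ℕ → Subset ℕ) → Subset (ℕ × ℕ)
  ⨁ A B (n , m) = A n × B n m

  ⨁-∈∑ : ∀ {A B} → U A → (∀ n → A n → V n (B n)) → ∑ U V (⨁ A B)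
  ⨁-∈∑ A∈U B∈V = U.upward (λ {n} An → V.upward n (An ,_) (B∈V n An)) A∈U

  restricted-⨁ : ∀ {X} → U X → Poset.Carrier (ℙ∏ X) → Poset.Carrier ℙ∑
  restricted-⨁ {X} X∈U ((A , A∈U) , B) =
    ⨁ (A ∩ X) (λ n → proj₁ (B n)) , ⨁-∈∑ (U.meet A∈U X∈U) (λ n _ → proj₂ (B n))

  restricted-⨁-convergent : ∀ {X} (X∈U : U X) → Convergent ℙ∑ (ℙ∏ X) (restricted-⨁ X∈U)
  restricted-⨁-convergent X∈U (S , S∈∑) =
    ((projection S , S∈∑) , guarded-fibre) ,
    λ { _ (A⊆πS , B⊆guarded) ((An , Xn) , Bnm) → B⊆guarded _ Xn Bnm (A⊆πS An) }
    where
    guarded-fibre : ∀ n → Poset.Carrier (filterPoset (V n))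
    guarded-fibre n =
      (λ m → projection S n → S (n , m)) , UltrafilterProperties.guarded-∈ (V-ultra n) (fibre S n)

  ∑≤T∏ : ∀ {X} → U X → ℙ∑ ≤T ℙ∏ X
  ∑≤T∏ X∈U = convergent⇒≤T ℙ∑ (ℙ∏ _) {restricted-⨁ X∈U} (restricted-⨁-convergent X∈U)

module ProductBelowSum (lem : ∀ {ℓ} → ExcludedMiddle ℓ)
    {U : Subset ℕ → Set} {V : ℕ → Subset ℕ → Set}
    (U-np : IsNonprincipalUltrafilter U) (V-ultra : ∀ n → IsUltrafilter (V n))
    {X₀ : Subset ℕ} (X₀∈U : U X₀)
    (V-monotone : ∀ n m → X₀ n → X₀ m → n ≤ m → filterPoset (V n) ≤T filterPoset (V m)) where

  open UltrafilterSum (IsNonprincipalUltrafilter.isUltrafilter U-np) V-ultra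
  open UltrafilterProperties using (⊤ᶠ; ⋂<-∈; const-∈⇒)
  private
    module U = IsUltrafilter (IsNonprincipalUltrafilter.isUltrafilter U-np)
    module V n = IsUltrafilter (V-ultra n)
    open Poset using (Carrier)

    ℙV : ℕ → Poset (lsuc 0ℓ) 0ℓ 0ℓ
    ℙV n = filterPoset (V n)

    dne : DoubleNegationElimination 0ℓ
    dne = em⇒dne lem

  -- Choices are made for all k and n, with a dummy value off Comparable k n, so that
  -- the thresholds for k ≤ n can be intersected.
  Comparable : ℕ → ℕ → Set
  Comparable k n = X₀ k × X₀ n × k ≤ n

  convergent-transfer : ∀ k n → Σ (Carrier (ℙV n) → Carrier (ℙV k)) λ T →
                        Comparable k n → Convergent (ℙV k) (ℙV n) T
  convergent-transfer k n = witness-when lem (λ _ → ⊤ᶠ (V-ultra k)) λ (Xk , Xn , k≤n) →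
    let t = V-monotone k n Xk Xn k≤n in proj₁ t , ≤T⇒convergent lem {P = ℙV k} {Q = ℙV n} t

  transfer : ∀ k n → Carrier (ℙV n) → Carrier (ℙV k)
  transfer k n = proj₁ (convergent-transfer k n)

  large-fibre-above : ∀ k (S : Carrier ℙ∑) → ∃ λ n → k ≤ n × X₀ n × projection (proj₁ S) n
  large-fibre-above k (S , S∈∑) = ∈⇒unbounded dne U-np (U.meet X₀∈U S∈∑) k

  decompose : Carrier ℙ∑ → Carrier (ℙ∏ X₀)
  decompose (S , S∈∑) = (projection S , S∈∑) , λ k →
    let (n , _ , _ , Sn∈V) = large-fibre-above k (S , S∈∑) in transfer k n (fibre S n , Sn∈V)

  decompose-convergent : Convergent (ℙ∏ X₀) ℙ∑ decompose
  decompose-convergent ((A , A∈U) , B) = (S₀ , S₀∈∑) , below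
    where
    threshold : ∀ k n → Σ (Carrier (ℙV n)) λ D →
                Comparable k n →
                ∀ S → Poset._≤_ (ℙV n) D S → Poset._≤_ (ℙV k) (B k) (transfer k n S)
    threshold k n = witness-when lem (⊤ᶠ (V-ultra n)) λ c → proj₂ (convergent-transfer k n) c (B k)

    D : ℕ → Subset ℕ
    D n m = ∀ k → k < suc n → proj₁ (proj₁ (threshold k n)) m

    S₀ : Subset (ℕ × ℕ)
    S₀ = ⨁ (A ∩ X₀) D

    S₀∈∑ : ∑ U V S₀
    S₀∈∑ = ⨁-∈∑ (U.meet A∈U X₀∈U) λ n _ →
      ⋂<-∈ (V-ultra n) _ (λ k → proj₂ (proj₁ (threshold k n))) (suc n)

    below : ∀ S → proj₁ S ⊆ S₀ → Poset._≤_ (ℙ∏ X₀) ((A , A∈U) , B) (decompose S)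
    below (S , S∈∑) S⊆S₀ = projection⊆A , B-below
      where
      projection⊆A : projection S ⊆ A
      projection⊆A {n} Sn∈V =
        const-∈⇒ (V-ultra n) dne (V.upward n (λ Snm → proj₁ (proj₁ (S⊆S₀ Snm))) Sn∈V)

      B-below : ∀ k → X₀ k → Poset._≤_ (ℙV k) (B k) (proj₂ (decompose (S , S∈∑)) k)
      B-below k Xk =
        let (n , k≤n , Xn , Sn∈V) = large-fibre-above k (S , S∈∑) in
        proj₂ (threshold k n) (Xk , Xn , k≤n) (fibre S n , Sn∈V)
              (λ Snm → proj₂ (S⊆S₀ Snm) k (s≤s k≤n))

lemma2p17 : ∀ {c ℓ₁ ℓ₂ : Level} → (lem : ∀ {ℓ} → ExcludedMiddle ℓ)
    → (U : Subset ℕ → Set) (V : ℕ → Subset ℕ → Set)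
    → IsNonprincipalUltrafilter U
    → (∀ n → IsNonprincipalUltrafilter (V n))
    → (X₀ : Subset ℕ) → U X₀
    → (∀ n m → X₀ n → X₀ m → n ≤ m → filterPoset (V n) ≤T filterPoset (V m))
    → (filterPoset (∑ U V) ≡T (filterPoset U ×ₚ ∏∈ X₀ (λ n → filterPoset (V n))))
      × (∀ (X : Subset ℕ) → U X
           → filterPoset (∑ U V) ≤T (filterPoset U ×ₚ ∏∈ X (λ n → filterPoset (V n))))
      × (∀ (P : Poset c ℓ₁ ℓ₂) → Directed P
           → (∀ (X : Subset ℕ) → U X
                → P ≤T (filterPoset U ×ₚ ∏∈ X (λ n → filterPoset (V n))))
           → P ≤T filterPoset (∑ U V))
lemma2p17 lem U V U-np V-np X₀ X₀∈U V-monotone =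
  (∑≤T∏ X₀∈U , convergent⇒≤T (ℙ∏ X₀) ℙ∑ {decompose} decompose-convergent) ,
  (λ X X∈U → ∑≤T∏ X∈U) ,
  λ P _ P≤T∏ → ≤T-∘-convergent {P = P} {Q = ℙ∏ X₀} {R = ℙ∑}
                  (P≤T∏ X₀ X₀∈U) {decompose} decompose-convergent
  where
  V-ultra : ∀ n → IsUltrafilter (V n)
  V-ultra n = IsNonprincipalUltrafilter.isUltrafilter (V-np n)
  open UltrafilterSum (IsNonprincipalUltrafilter.isUltrafilter U-np) V-ultra
  open ProductBelowSum lem U-np V-ultra X₀∈U V-monotone
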